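{- Let $m\ge2$, $n\ge1$, let $G$ be a finite Abelian group and $(s_1,\dots,s_n)\in G^n$ with $G\ge[-m+1,m]^*\diamond_2 (s_1,\dots,s_n)$. Let $M_1$ be the number of ordered quadruples $(i,j,k,l)$ with $(i,j)\in\Delta$, $(k,l)\in\Delta$, $i\equiv l\pmod n$, $k\not\equiv j\pmod n$ and $s_i-s_j=s_k-s_l$. Then $M_1\le 2m^2n$.
   Context: $[a,b]=\{a,\dots,b\}$, $[a,b]^*=[a,b]\setminus\{0\}$. For a finite Abelian group $G$, finite $M\subseteq\mathbb{Z}\setminus\{0\}$ and $S=(s_1,\dots,s_n)\in G^n$, $G\ge M\diamond_t S$ means the elements $\sum_i e_is_i$, for $\mathbf{e}\in(M\cup\{0\})^n$ with $1\le\mathrm{wt}(\mathbf{e})\le t$ (Hamming weight), are nonzero and pairwise distinct for distinct $\mathbf{e}$. Extend the indexing: for $i\in[1,n]$ and $1\le k\le m-1$ put $s_{i+kn}=(k+1)s_i$ and $s_{i-kn}=-ks_i$, and put $s_\infty=0$. Let $J=[1-n(m-1),nm]\cup\{\infty\}$. Congruence mod $n$ among integer indices is the usual one; $\infty\equiv\infty\pmod n$ and $\infty$ is not congruent to any integer index. Let $\Delta=\{(i,j)\in J^2 : i\not\equiv j\pmod n\}$. -}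

module Defs where

open import Level using (Level)
open import Algebra.Bundles using (AbelianGroup)
open import Data.Nat as ℕ using (ℕ; zero; suc; _∸_)
open import Data.Integer as ℤ using (ℤ; +_; -[1+_])
open import Data.Fin using (Fin; toℕ)
open import Data.Fin.Properties using () renaming (_≟_ to _≟F_)
open import Data.Maybe using (Maybe; just; nothing)
open import Data.Maybe.Properties using (≡-dec)
open import Data.List using (List; []; _∷_; _++_; map; concatMap; filter; length; allFin)
open import Data.Product using (_×_; _,_)
open import Data.Sum using (_⊎_)
open import Relation.Binary.PropositionalEquality using (_≡_)
open import Relation.Binary.Definitions using (Decidable)
open import Relation.Nullary using (¬_; Dec; yes; no)
open import Relation.Nullary.Decidable using (_×-dec_; ¬?)

-- The extended index set J = [1-n(m-1), nm] ∪ {∞}, encoded by cases: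
--   pos i k  (i : Fin n, k : Fin m)        is the integer index (i+1) + k n,   s = (k+1) s_{i+1}
--   neg i k  (i : Fin n, k : Fin (m ∸ 1))  is the integer index (i+1) - (k+1) n, s = -(k+1) s_{i+1}
--   inf                                    is ∞,                               s = 0
-- (k = 0 in pos gives the original indices 1..n.)  This is a bijection onto J.
data J (n m : ℕ) : Set where
  pos : Fin n → Fin m → J n m
  neg : Fin n → Fin (m ∸ 1) → J n m
  inf : J n m

index : ∀ {n m} → J n m → Maybe ℤ
index {n} (pos i k) = just (+ (suc (toℕ i) ℕ.+ toℕ k ℕ.* n))
index {n} (neg i k) = just (+ suc (toℕ i) ℤ.- + (suc (toℕ k) ℕ.* n))
index inf = nothing

residue : ∀ {n m} → J n m → Maybe (Fin n)
residue (pos i _) = just i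
residue (neg i _) = just i
residue inf = nothing

_≡ₙ_ : ∀ {n m} → J n m → J n m → Set
a ≡ₙ b = residue a ≡ residue b

_≡ₙ?_ : ∀ {n m} → (a b : J n m) → Dec (a ≡ₙ b)
a ≡ₙ? b = ≡-dec _≟F_ (residue a) (residue b)

allJ : (n m : ℕ) → List (J n m)
allJ n m = inf ∷ (concatMap (λ i → map (pos i) (allFin m)) (allFin n)
               ++ concatMap (λ i → map (neg i) (allFin (m ∸ 1))) (allFin n))

InM : ℕ → ℤ → Set
InM m z = (ℤ.- (+ m) ℤ.+ ℤ.1ℤ ℤ.≤ z) × (z ℤ.≤ + m) × ¬ (z ≡ ℤ.0ℤ)

wt : ∀ {n} → (Fin n → ℤ) → ℕ
wt {zero} e = 0
wt {suc n} e with e Data.Fin.zero ℤ.≟ ℤ.0ℤ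
... | yes _ = wt (λ i → e (Data.Fin.suc i))
... | no _ = suc (wt (λ i → e (Data.Fin.suc i)))

module GroupDefs {c ℓ : Level} (G : AbelianGroup c ℓ) where
  open AbelianGroup G

  _·ℕ_ : ℕ → Carrier → Carrier
  zero ·ℕ x = ε
  suc k ·ℕ x = x ∙ (k ·ℕ x)

  _·ℤ_ : ℤ → Carrier → Carrier
  (+ k) ·ℤ x = k ·ℕ x
  -[1+ k ] ·ℤ x = (suc k ·ℕ x) ⁻¹

  lin : ∀ {n} → (Fin n → ℤ) → (Fin n → Carrier) → Carrier
  lin {zero} e s = ε
  lin {suc n} e s = (e Data.Fin.zero ·ℤ s Data.Fin.zero)
                    ∙ lin (λ i → e (Data.Fin.suc i)) (λ i → s (Data.Fin.suc i))

  Diamond : (M : ℤ → Set) (t : ℕ) {n : ℕ} → (Fin n → Carrier) → Set ℓ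
  Diamond M t {n} s =
    ∀ (e e′ : Fin n → ℤ) →
    (∀ i → M (e i) ⊎ e i ≡ ℤ.0ℤ) → 1 ℕ.≤ wt e → wt e ℕ.≤ t →
    (∀ i → M (e′ i) ⊎ e′ i ≡ ℤ.0ℤ) → 1 ℕ.≤ wt e′ → wt e′ ℕ.≤ t →
    ¬ (lin e s ≈ ε) × (lin e s ≈ lin e′ s → ∀ i → e i ≡ e′ i)

  sJ : ∀ {n m} → (Fin n → Carrier) → J n m → Carrier
  sJ s (pos i k) = suc (toℕ k) ·ℕ s i
  sJ s (neg i k) = (suc (toℕ k) ·ℕ s i) ⁻¹
  sJ s inf = ε

  module Count (_≟_ : Decidable _≈_) where
    Quad : ℕ → ℕ → Set
    Quad n m = J n m × J n m × J n m × J n m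

    allQuads : (n m : ℕ) → List (Quad n m)
    allQuads n m =
      concatMap (λ i → concatMap (λ j → concatMap (λ k → map (λ l → i , j , k , l)
        (allJ n m)) (allJ n m)) (allJ n m)) (allJ n m)

    good? : ∀ {n m} (s : Fin n → Carrier) (q : Quad n m) → Dec _
    good? s (i , j , k , l) =
      ¬? (i ≡ₙ? j) ×-dec ¬? (k ≡ₙ? l) ×-dec (i ≡ₙ? l) ×-dec ¬? (k ≡ₙ? j)
      ×-dec ((sJ s i - sJ s j) ≟ (sJ s k - sJ s l))

    M₁ : (n m : ℕ) → (Fin n → Carrier) → ℕ
    M₁ n m s = length (filter (good? s) (allQuads n m))

module Submission where

-- Write s_i − s_j = s_k − s_l as s_i + s_l = s_k + s_j. Each s_j (j ∈ J) is c_j·s_r for the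
-- residue r of j and a coefficient c_j ∈ [1−m, m] (c_∞ = 0), so both sides are integer
-- combinations of s_1, …, s_n of weight at most 2, the left one living on the single generator of
-- the residue of i ≡ l, with coefficient c_i + c_l. If c_i + c_l ∈ [1−m, m], the ◇₂ condition
-- (nonvanishing and injectivity) forces the two coefficient vectors to agree, which is impossible
-- because neither k nor j is congruent to l. Otherwise ◇₂ still pins down the coefficient vector
-- of s_k + s_j, hence the unordered pair {k, j}: at most two quadruples for each such (i, l).
-- For fixed i at most |c_i| indices l make c_i + c_l leave [1−m, m], and
-- Σ_i |c_i| = n(1 + ⋯ + m) + n(1 + ⋯ + (m − 1)) = n m².

open import Defs
open import Level using (Level)
open import Algebra.Bundles using (AbelianGroup)
open import Data.Bool using (true; false; if_then_else_)
open import Data.Nat using (ℕ; zero; suc; _+_; _*_; _∸_; _≤_; _<_; z≤n; s≤s)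
open import Data.Nat.Properties hiding (_≟_)
open import Algebra.Properties.CommutativeSemigroup +-commutativeSemigroup
  using () renaming (interchange to +-interchange)
open import Data.Nat.ListAction using (sum)
import Data.Nat.ListAction.Properties as Sum
open import Data.Nat.Tactic.RingSolver using (solve-∀)
open import Data.Integer as ℤ using (ℤ; -[1+_]; _⊖_; 0ℤ; +≤+; -≤+; -≤-)
import Data.Integer.Properties as ℤ
open import Data.Fin using (Fin; toℕ) renaming (zero to fzero; suc to fsuc)
open import Data.Fin.Properties using (toℕ<n; toℕ-injective; ¬∀⟶∃¬)
  renaming (_≟_ to _≟ᶠ_; suc-injective to fsuc-injective)
open import Data.List using (List; []; _∷_; _++_; map; concatMap; filter; length; tabulate;
  applyUpTo; upTo; allFin; cartesianProductWith; cartesianProduct)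
open import Data.List.Properties using (map-++; map-∘; map-cong; length-++; length-map;
  length-tabulate; map-tabulate; upTo-∷ʳ; filter-none)
open import Data.List.Membership.Propositional using (_∈_)
open import Data.List.Membership.Propositional.Properties
  using (∈-∃++; ∈-++⁻; ∈-++⁺ˡ; ∈-++⁺ʳ; ∈-map⁺; ∈-filter⁺; ∈-filter⁻; ∈-allFin;
         ∈-cartesianProductWith⁻)
open import Data.List.Relation.Binary.Subset.Propositional using (_⊆_)
open import Data.List.Relation.Unary.Any using (here; there; any?; satisfied)
import Data.List.Relation.Unary.All as All
open import Data.List.Relation.Unary.All.Properties using (¬Any⇒All¬)
open import Data.List.Relation.Unary.Unique.Propositional using (Unique; _∷_)
open import Data.List.Relation.Unary.Unique.Propositional.Properties
  using (++⁺; cartesianProductWith⁺; cartesianProduct⁺; allFin⁺; filter⁺)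
open import Data.Maybe using (Maybe; just)
open import Data.Maybe.Properties using (just-injective; ≡-dec)
open import Data.Product using (_×_; _,_; ∃; proj₁; proj₂)
open import Data.Sum using (_⊎_; inj₁; inj₂; [_,_]′)
open import Data.Empty using (⊥)
open import Function using (_∘_)
open import Relation.Binary.Definitions using (Decidable)
open import Relation.Binary.PropositionalEquality
  using (_≡_; _≢_; refl; sym; trans; cong; cong₂; subst; module ≡-Reasoning)
open import Relation.Nullary using (Dec; does; yes; no; ¬_; contradiction)
open import Relation.Nullary.Decidable
  using (_×-dec_; _⊎-dec_; ¬?; dec-true; dec-false; decidable-stable)
open import Relation.Unary using (Pred)
import Relation.Unary as U

private variable
  a p q : Level
  A B C : Set a

-- Sums and counts over lists

𝟙 : {P : Set p} → Dec P → ℕ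
𝟙 P? = if does P? then 1 else 0

𝟙≤1 : {P : Set p} (P? : Dec P) → 𝟙 P? ≤ 1
𝟙≤1 (yes _) = s≤s z≤n
𝟙≤1 (no _)  = z≤n

𝟙-≡0 : {P : Set p} (P? : Dec P) → ¬ P → 𝟙 P? ≡ 0
𝟙-≡0 (yes p) ¬p = contradiction p ¬p
𝟙-≡0 (no _)  _  = refl

𝟙-mono : {P : Set p} {Q : Set q} (P? : Dec P) (Q? : Dec Q) → (P → Q) → 𝟙 P? ≤ 𝟙 Q?
𝟙-mono (yes p) (yes _) _   = ≤-refl
𝟙-mono (yes p) (no ¬q) p→q = contradiction (p→q p) ¬q
𝟙-mono (no _)  _       _   = z≤n

∑-syntax : List A → (A → ℕ) → ℕ
∑-syntax xs f = sum (map f xs)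

syntax ∑-syntax xs (λ x → e) = ∑[ x ∈ xs ] e

module _ {f g : A → ℕ} where

  ∑-cong : ∀ xs → (∀ x → f x ≡ g x) → ∑[ x ∈ xs ] f x ≡ ∑[ x ∈ xs ] g x
  ∑-cong xs f≗g = cong sum (map-cong f≗g xs)

  ∑-mono-≤ : ∀ xs → (∀ x → f x ≤ g x) → ∑[ x ∈ xs ] f x ≤ ∑[ x ∈ xs ] g x
  ∑-mono-≤ []       f≤g = z≤n
  ∑-mono-≤ (x ∷ xs) f≤g = +-mono-≤ (f≤g x) (∑-mono-≤ xs f≤g)

  ∑-distrib-+ : ∀ xs → ∑[ x ∈ xs ] (f x + g x) ≡ ∑[ x ∈ xs ] f x + ∑[ x ∈ xs ] g x
  ∑-distrib-+ []       = refl
  ∑-distrib-+ (x ∷ xs) =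
    trans (cong (f x + g x +_) (∑-distrib-+ xs)) (+-interchange (f x) (g x) _ _)

∑-*-distribˡ : ∀ c (f : A → ℕ) xs → ∑[ x ∈ xs ] (c * f x) ≡ c * ∑[ x ∈ xs ] f x
∑-*-distribˡ c f []       = sym (*-zeroʳ c)
∑-*-distribˡ c f (x ∷ xs) =
  trans (cong (c * f x +_) (∑-*-distribˡ c f xs)) (sym (*-distribˡ-+ c (f x) _))

∑-const : ∀ c (xs : List A) → ∑[ x ∈ xs ] c ≡ length xs * c
∑-const c []       = refl
∑-const c (x ∷ xs) = cong (c +_) (∑-const c xs)

∑-++ : ∀ (f : A → ℕ) xs ys →
       ∑[ x ∈ xs ++ ys ] f x ≡ ∑[ x ∈ xs ] f x + ∑[ y ∈ ys ] f y
∑-++ f xs ys = trans (cong sum (map-++ f xs ys)) (Sum.sum-++ (map f xs) (map f ys))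

∑-map : ∀ (f : B → ℕ) (g : A → B) xs → ∑[ y ∈ map g xs ] f y ≡ ∑[ x ∈ xs ] f (g x)
∑-map f g xs = cong sum (sym (map-∘ xs))

∑-concatMap : ∀ (f : B → ℕ) (g : A → List B) xs →
              ∑[ y ∈ concatMap g xs ] f y ≡ ∑[ x ∈ xs ] ∑[ y ∈ g x ] f y
∑-concatMap f g []       = refl
∑-concatMap f g (x ∷ xs) =
  trans (∑-++ f (g x) (concatMap g xs)) (cong (∑[ y ∈ g x ] f y +_) (∑-concatMap f g xs))

∑-cartesianProductWith : ∀ (f : C → ℕ) (g : A → B → C) xs ys →
  ∑[ z ∈ cartesianProductWith g xs ys ] f z ≡ ∑[ x ∈ xs ] ∑[ y ∈ ys ] f (g x y)
∑-cartesianProductWith f g []       ys = refl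
∑-cartesianProductWith f g (x ∷ xs) ys = begin
  ∑[ z ∈ map (g x) ys ++ cartesianProductWith g xs ys ] f z
    ≡⟨ ∑-++ f (map (g x) ys) _ ⟩
  ∑[ z ∈ map (g x) ys ] f z + ∑[ z ∈ cartesianProductWith g xs ys ] f z
    ≡⟨ cong₂ _+_ (∑-map f (g x) ys) (∑-cartesianProductWith f g xs ys) ⟩
  ∑[ y ∈ ys ] f (g x y) + ∑[ x′ ∈ xs ] ∑[ y ∈ ys ] f (g x′ y) ∎
  where open ≡-Reasoning

∑-comm : ∀ (f : A → B → ℕ) xs ys →
         ∑[ x ∈ xs ] ∑[ y ∈ ys ] f x y ≡ ∑[ y ∈ ys ] ∑[ x ∈ xs ] f x y
∑-comm f []       ys = sym (trans (∑-const 0 ys) (*-zeroʳ (length ys)))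
∑-comm f (x ∷ xs) ys =
  trans (cong (∑[ y ∈ ys ] f x y +_) (∑-comm f xs ys)) (sym (∑-distrib-+ ys))

module _ {P : Pred A p} (P? : U.Decidable P) where

  length-filter≡∑𝟙 : ∀ xs → length (filter P? xs) ≡ ∑[ x ∈ xs ] 𝟙 (P? x)
  length-filter≡∑𝟙 []       = refl
  length-filter≡∑𝟙 (x ∷ xs) with does (P? x)
  ... | true  = cong suc (length-filter≡∑𝟙 xs)
  ... | false = length-filter≡∑𝟙 xs

length-≤-⊆ : {xs ys : List A} → Unique xs → xs ⊆ ys → length xs ≤ length ys
length-≤-⊆ {xs = []}     _            _       = z≤n
length-≤-⊆ {xs = x ∷ xs} (x∉xs ∷ !xs) x∷xs⊆ys with ∈-∃++ (x∷xs⊆ys (here refl))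
... | us , vs , refl = begin
  suc (length xs)             ≤⟨ s≤s (length-≤-⊆ !xs xs⊆us++vs) ⟩
  suc (length (us ++ vs))     ≡⟨ cong suc (length-++ us) ⟩
  suc (length us + length vs) ≡⟨ +-suc (length us) (length vs) ⟨
  length us + length (x ∷ vs) ≡⟨ length-++ us ⟨
  length (us ++ x ∷ vs)       ∎
  where
  open ≤-Reasoning
  xs⊆us++vs : xs ⊆ us ++ vs
  xs⊆us++vs {y} y∈xs with ∈-++⁻ us (x∷xs⊆ys (there y∈xs))
  ... | inj₁ y∈us         = ∈-++⁺ˡ y∈us
  ... | inj₂ (here refl)  = contradiction refl (All.lookup x∉xs y∈xs)
  ... | inj₂ (there y∈vs) = ∈-++⁺ʳ us y∈vs

concatMap-map≡cartesianProductWith : ∀ (f : A → B → C) xs ys →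
  concatMap (λ x → map (f x) ys) xs ≡ cartesianProductWith f xs ys
concatMap-map≡cartesianProductWith f []       ys = refl
concatMap-map≡cartesianProductWith f (x ∷ xs) ys =
  cong (map (f x) ys ++_) (concatMap-map≡cartesianProductWith f xs ys)

quadruples : List A → List (A × A × A × A)
quadruples xs = concatMap (λ i → concatMap (λ j → concatMap (λ k →
                  map (λ l → i , j , k , l) xs) xs) xs) xs

∑-quadruples : ∀ (xs : List A) (f : A × A × A × A → ℕ) →
  ∑[ q ∈ quadruples xs ] f q
  ≡ ∑[ i ∈ xs ] ∑[ l ∈ xs ] ∑[ p ∈ cartesianProduct xs xs ] f (i , proj₁ p , proj₂ p , l)
∑-quadruples xs f = begin
  ∑[ q ∈ quadruples xs ] f q
    ≡⟨ trans (∑-concatMap f _ xs) (∑-cong xs λ i → trans (∑-concatMap f _ xs) (∑-cong xs λ j →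
         trans (∑-concatMap f _ xs) (∑-cong xs λ k → ∑-map f _ xs))) ⟩
  ∑[ i ∈ xs ] ∑[ j ∈ xs ] ∑[ k ∈ xs ] ∑[ l ∈ xs ] f (i , j , k , l)
    ≡⟨ ∑-cong xs (λ i → trans (∑-cong xs λ j → ∑-comm (λ k l → f (i , j , k , l)) xs xs)
                              (∑-comm (λ j l → ∑[ k ∈ xs ] f (i , j , k , l)) xs xs)) ⟩
  ∑[ i ∈ xs ] ∑[ l ∈ xs ] ∑[ j ∈ xs ] ∑[ k ∈ xs ] f (i , j , k , l)
    ≡⟨ ∑-cong xs (λ i → ∑-cong xs λ l →
         sym (∑-cartesianProductWith (λ p → f (i , proj₁ p , proj₂ p , l)) _,_ xs xs)) ⟩
  ∑[ i ∈ xs ] ∑[ l ∈ xs ] ∑[ p ∈ cartesianProduct xs xs ] f (i , proj₁ p , proj₂ p , l) ∎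
  where open ≡-Reasoning

-- Triangular numbers and counting in Fin

tabulate-toℕ : ∀ {A : Set} n (f : ℕ → A) → tabulate {n = n} (f ∘ toℕ) ≡ applyUpTo f n
tabulate-toℕ zero    f = refl
tabulate-toℕ (suc n) f = cong (f 0 ∷_) (tabulate-toℕ n (f ∘ suc))

∑-allFin : ∀ n (f : ℕ → ℕ) → ∑[ k ∈ allFin n ] f (toℕ k) ≡ ∑[ x ∈ upTo n ] f x
∑-allFin n f = begin
  ∑[ k ∈ allFin n ] f (toℕ k)
    ≡⟨ ∑-map f toℕ (allFin n) ⟨
  ∑[ x ∈ map toℕ (allFin n) ] f x
    ≡⟨ cong (λ xs → ∑[ x ∈ xs ] f x) (map-tabulate {n = n} (λ k → k) toℕ) ⟩
  ∑[ x ∈ tabulate {n = n} toℕ ] f x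
    ≡⟨ cong (λ xs → ∑[ x ∈ xs ] f x) (tabulate-toℕ n (λ x → x)) ⟩
  ∑[ x ∈ upTo n ] f x ∎
  where open ≡-Reasoning

∑-upTo-∷ʳ : ∀ n (f : ℕ → ℕ) → ∑[ x ∈ upTo (suc n) ] f x ≡ ∑[ x ∈ upTo n ] f x + f n
∑-upTo-∷ʳ n f = begin
  ∑[ x ∈ upTo (suc n) ] f x          ≡⟨ cong (λ xs → ∑[ x ∈ xs ] f x) (upTo-∷ʳ n) ⟨
  ∑[ x ∈ upTo n ++ n ∷ [] ] f x      ≡⟨ ∑-++ f (upTo n) (n ∷ []) ⟩
  ∑[ x ∈ upTo n ] f x + (f n + 0)    ≡⟨ cong (∑[ x ∈ upTo n ] f x +_) (+-identityʳ (f n)) ⟩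
  ∑[ x ∈ upTo n ] f x + f n          ∎
  where open ≡-Reasoning

triangle : ℕ → ℕ
triangle n = ∑[ x ∈ upTo n ] suc x

triangle-suc+triangle : ∀ n → triangle (suc n) + triangle n ≡ suc n * suc n
triangle-suc+triangle zero    = refl
triangle-suc+triangle (suc n) = begin
  triangle (suc (suc n)) + triangle (suc n)
    ≡⟨ cong₂ _+_ (∑-upTo-∷ʳ (suc n) suc) (∑-upTo-∷ʳ n suc) ⟩
  (triangle (suc n) + suc (suc n)) + (triangle n + suc n)
    ≡⟨ regroup (triangle (suc n)) (triangle n) n ⟩
  (triangle (suc n) + triangle n) + (suc (suc n) + suc n)
    ≡⟨ cong (_+ (suc (suc n) + suc n)) (triangle-suc+triangle n) ⟩
  suc n * suc n + (suc (suc n) + suc n)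
    ≡⟨ square-suc n ⟩
  suc (suc n) * suc (suc n) ∎
  where
  open ≡-Reasoning
  regroup : ∀ a b n → (a + suc (suc n)) + (b + suc n) ≡ (a + b) + (suc (suc n) + suc n)
  regroup = solve-∀
  square-suc : ∀ n → suc n * suc n + (suc (suc n) + suc n) ≡ suc (suc n) * suc (suc n)
  square-suc = solve-∀

triangle+triangle-pred : ∀ m → triangle m + triangle (m ∸ 1) ≡ m * m
triangle+triangle-pred zero    = refl
triangle+triangle-pred (suc m) = triangle-suc+triangle m

∑-upTo-𝟙[b<c+1+x]≤c : ∀ b c → ∑[ x ∈ upTo b ] 𝟙 (b <? c + suc x) ≤ c
∑-upTo-𝟙[b<c+1+x]≤c zero    c       = z≤n
∑-upTo-𝟙[b<c+1+x]≤c (suc b) zero    = begin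
  ∑[ x ∈ upTo (suc b) ] 𝟙 (suc b <? suc x)
    ≡⟨ ∑-upTo-∷ʳ b _ ⟩
  ∑[ x ∈ upTo b ] 𝟙 (suc b <? suc x) + 𝟙 (suc b <? suc b)
    ≤⟨ +-mono-≤ (∑-mono-≤ (upTo b) shrink) (≤-reflexive (𝟙-≡0 (suc b <? suc b) (<-irrefl refl))) ⟩
  ∑[ x ∈ upTo b ] 𝟙 (b <? suc x) + 0
    ≤⟨ +-monoˡ-≤ 0 (∑-upTo-𝟙[b<c+1+x]≤c b zero) ⟩
  0 ∎
  where
  open ≤-Reasoning
  shrink : ∀ x → 𝟙 (suc b <? suc x) ≤ 𝟙 (b <? suc x)
  shrink x = 𝟙-mono (suc b <? suc x) (b <? suc x) (m<n⇒m<1+n ∘ ≤-pred)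
∑-upTo-𝟙[b<c+1+x]≤c (suc b) (suc c) = begin
  ∑[ x ∈ upTo (suc b) ] 𝟙 (suc b <? suc c + suc x)
    ≡⟨ ∑-upTo-∷ʳ b _ ⟩
  ∑[ x ∈ upTo b ] 𝟙 (suc b <? suc c + suc x) + 𝟙 (suc b <? suc c + suc b)
    ≤⟨ +-mono-≤ (∑-mono-≤ (upTo b) shrink) (𝟙≤1 (suc b <? suc c + suc b)) ⟩
  ∑[ x ∈ upTo b ] 𝟙 (b <? c + suc x) + 1
    ≤⟨ +-monoˡ-≤ 1 (∑-upTo-𝟙[b<c+1+x]≤c b c) ⟩
  c + 1
    ≡⟨ +-comm c 1 ⟩
  suc c ∎
  where
  open ≤-Reasoning
  shrink : ∀ x → 𝟙 (suc b <? suc c + suc x) ≤ 𝟙 (b <? c + suc x)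
  shrink x = 𝟙-mono (suc b <? suc c + suc x) (b <? c + suc x) ≤-pred

topFins : ∀ b → ℕ → List (Fin b)
topFins b c = filter (λ k → b <? c + suc (toℕ k)) (allFin b)

length-topFins : ∀ b c → length (topFins b c) ≤ c
length-topFins b c = begin
  length (topFins b c)
    ≡⟨ length-filter≡∑𝟙 (λ k → b <? c + suc (toℕ k)) (allFin b) ⟩
  ∑[ k ∈ allFin b ] 𝟙 (b <? c + suc (toℕ k))
    ≡⟨ ∑-allFin b (λ x → 𝟙 (b <? c + suc x)) ⟩
  ∑[ x ∈ upTo b ] 𝟙 (b <? c + suc x)
    ≤⟨ ∑-upTo-𝟙[b<c+1+x]≤c b c ⟩
  c ∎
  where open ≤-Reasoning

𝟙≢0 : ℤ → ℕ
𝟙≢0 z = 𝟙 (¬? (z ℤ.≟ 0ℤ))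

𝟙≢0-subadditive : ∀ a b → 𝟙≢0 (a ℤ.+ b) ≤ 𝟙≢0 a + 𝟙≢0 b
𝟙≢0-subadditive a b with a ℤ.≟ 0ℤ | b ℤ.≟ 0ℤ
... | yes refl | yes refl = z≤n
... | yes _    | no _     = 𝟙≤1 (¬? (a ℤ.+ b ℤ.≟ 0ℤ))
... | no _     | _        = ≤-trans (𝟙≤1 (¬? (a ℤ.+ b ℤ.≟ 0ℤ))) (s≤s z≤n)

wt-suc : ∀ {n} (e : Fin (suc n) → ℤ) → wt e ≡ 𝟙≢0 (e fzero) + wt (e ∘ fsuc)
wt-suc e with e fzero ℤ.≟ 0ℤ
... | yes _ = refl
... | no _  = refl

wt-zero : ∀ {n} (e : Fin n → ℤ) → (∀ t → e t ≡ 0ℤ) → wt e ≡ 0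
wt-zero {zero}  e e≗0 = refl
wt-zero {suc n} e e≗0 = trans (wt-suc e) (cong₂ _+_
  (𝟙-≡0 (¬? (e fzero ℤ.≟ 0ℤ)) (λ e₀≢0 → e₀≢0 (e≗0 fzero))) (wt-zero (e ∘ fsuc) (e≗0 ∘ fsuc)))

wt-pos : ∀ {n} (e : Fin n → ℤ) t → e t ≢ 0ℤ → 1 ≤ wt e
wt-pos {suc n} e t eₜ≢0 with e fzero ℤ.≟ 0ℤ
wt-pos e fzero    eₜ≢0 | yes e₀≡0 = contradiction e₀≡0 eₜ≢0
wt-pos e (fsuc t) eₜ≢0 | yes _    = wt-pos (e ∘ fsuc) t eₜ≢0
wt-pos e t        eₜ≢0 | no _     = s≤s z≤n

wt-supported : ∀ {n} (e : Fin n → ℤ) α → (∀ t → t ≢ α → e t ≡ 0ℤ) → wt e ≤ 1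
wt-supported {suc n} e fzero e≗0 = ≤-trans (≤-reflexive (wt-suc e)) (+-mono-≤
  (𝟙≤1 (¬? (e fzero ℤ.≟ 0ℤ))) (≤-reflexive (wt-zero (e ∘ fsuc) λ t → e≗0 (fsuc t) λ ())))
wt-supported {suc n} e (fsuc α) e≗0 with e fzero ℤ.≟ 0ℤ
... | yes _   = wt-supported (e ∘ fsuc) α λ t t≢α → e≗0 (fsuc t) (t≢α ∘ fsuc-injective)
... | no e₀≢0 = contradiction (e≗0 fzero λ ()) e₀≢0

wt-+ : ∀ {n} (e e′ : Fin n → ℤ) → wt (λ t → e t ℤ.+ e′ t) ≤ wt e + wt e′
wt-+ {zero}  e e′ = z≤n
wt-+ {suc n} e e′ = begin
  wt (λ t → e t ℤ.+ e′ t)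
    ≡⟨ wt-suc (λ t → e t ℤ.+ e′ t) ⟩
  𝟙≢0 (e fzero ℤ.+ e′ fzero) + wt (λ t → e (fsuc t) ℤ.+ e′ (fsuc t))
    ≤⟨ +-mono-≤ (𝟙≢0-subadditive (e fzero) (e′ fzero)) (wt-+ (e ∘ fsuc) (e′ ∘ fsuc)) ⟩
  (𝟙≢0 (e fzero) + 𝟙≢0 (e′ fzero)) + (wt (e ∘ fsuc) + wt (e′ ∘ fsuc))
    ≡⟨ +-interchange (𝟙≢0 (e fzero)) (𝟙≢0 (e′ fzero)) (wt (e ∘ fsuc)) (wt (e′ ∘ fsuc)) ⟩
  (𝟙≢0 (e fzero) + wt (e ∘ fsuc)) + (𝟙≢0 (e′ fzero) + wt (e′ ∘ fsuc))
    ≡⟨ cong₂ _+_ (wt-suc e) (wt-suc e′) ⟨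
  wt e + wt e′ ∎
  where open ≤-Reasoning

-- Integer combinations in an abelian group

module LinearCombinations {c ℓ : Level} (G : AbelianGroup c ℓ) where
  open AbelianGroup G renaming (refl to ≈-refl; sym to ≈-sym; trans to ≈-trans)
  open GroupDefs G
  open import Algebra.Properties.AbelianGroup G using (⁻¹-∙-comm)
  open import Algebra.Properties.Group group using (ε⁻¹≈ε)
  open import Algebra.Properties.CommutativeSemigroup commutativeSemigroup using (interchange)
  open import Relation.Binary.Reasoning.Setoid setoid

  ·ℕ-homo-+ : ∀ a b x → (a + b) ·ℕ x ≈ a ·ℕ x ∙ b ·ℕ x
  ·ℕ-homo-+ zero    b x = ≈-sym (identityˡ _)
  ·ℕ-homo-+ (suc a) b x = ≈-trans (∙-congˡ (·ℕ-homo-+ a b x)) (≈-sym (assoc _ _ _))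

  ⊖-·ℤ : ∀ a b x → (a ⊖ b) ·ℤ x ≈ a ·ℕ x - b ·ℕ x
  ⊖-·ℤ zero    zero    x = ≈-sym (≈-trans (∙-congˡ ε⁻¹≈ε) (identityʳ ε))
  ⊖-·ℤ zero    (suc b) x = ≈-sym (identityˡ _)
  ⊖-·ℤ (suc a) zero    x = ≈-sym (≈-trans (∙-congˡ ε⁻¹≈ε) (identityʳ _))
  ⊖-·ℤ (suc a) (suc b) x = begin
    (suc a ⊖ suc b) ·ℤ x                 ≡⟨ cong (_·ℤ x) (ℤ.[1+m]⊖[1+n]≡m⊖n a b) ⟩
    (a ⊖ b) ·ℤ x                         ≈⟨ ⊖-·ℤ a b x ⟩
    a ·ℕ x - b ·ℕ x                      ≈⟨ identityˡ _ ⟨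
    ε ∙ (a ·ℕ x - b ·ℕ x)                ≈⟨ ∙-congʳ (inverseʳ x) ⟨
    (x - x) ∙ (a ·ℕ x - b ·ℕ x)          ≈⟨ interchange _ _ _ _ ⟩
    (x ∙ a ·ℕ x) ∙ (x ⁻¹ ∙ (b ·ℕ x) ⁻¹)  ≈⟨ ∙-congˡ (⁻¹-∙-comm x _) ⟩
    (x ∙ a ·ℕ x) - (x ∙ b ·ℕ x)          ∎

  ·ℤ-homo-+ : ∀ z w x → (z ℤ.+ w) ·ℤ x ≈ z ·ℤ x ∙ w ·ℤ x
  ·ℤ-homo-+ (ℤ.+ a)  (ℤ.+ b)  x = ·ℕ-homo-+ a b x
  ·ℤ-homo-+ (ℤ.+ a)  -[1+ b ] x = ⊖-·ℤ a (suc b) x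
  ·ℤ-homo-+ -[1+ a ] (ℤ.+ b)  x = ≈-trans (⊖-·ℤ b (suc a) x) (comm _ _)
  ·ℤ-homo-+ -[1+ a ] -[1+ b ] x = begin
    (suc (suc (a + b)) ·ℕ x) ⁻¹        ≡⟨ cong (λ k → (suc k ·ℕ x) ⁻¹) (+-suc a b) ⟨
    ((suc a + suc b) ·ℕ x) ⁻¹          ≈⟨ ⁻¹-cong (·ℕ-homo-+ (suc a) (suc b) x) ⟩
    (suc a ·ℕ x ∙ suc b ·ℕ x) ⁻¹       ≈⟨ ⁻¹-∙-comm _ _ ⟨
    (suc a ·ℕ x) ⁻¹ ∙ (suc b ·ℕ x) ⁻¹  ∎

  lin-homo-+ : ∀ {n} (e e′ : Fin n → ℤ) (s : Fin n → Carrier) →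
               lin (λ t → e t ℤ.+ e′ t) s ≈ lin e s ∙ lin e′ s
  lin-homo-+ {zero}  e e′ s = ≈-sym (identityˡ ε)
  lin-homo-+ {suc n} e e′ s = ≈-trans
    (∙-cong (·ℤ-homo-+ (e fzero) (e′ fzero) (s fzero))
            (lin-homo-+ (e ∘ fsuc) (e′ ∘ fsuc) (s ∘ fsuc)))
    (interchange _ _ _ _)

  lin-zero : ∀ {n} {e : Fin n → ℤ} (s : Fin n → Carrier) →
             (∀ t → e t ≡ 0ℤ) → lin e s ≈ ε
  lin-zero {zero}  s e≗0 = ≈-refl
  lin-zero {suc n} s e≗0 = ≈-trans
    (∙-cong (reflexive (cong (_·ℤ s fzero) (e≗0 fzero))) (lin-zero (s ∘ fsuc) (e≗0 ∘ fsuc)))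
    (identityˡ ε)

  lin-supported : ∀ {n} {e : Fin n → ℤ} (s : Fin n → Carrier) (α : Fin n) →
                  (∀ t → t ≢ α → e t ≡ 0ℤ) → lin e s ≈ e α ·ℤ s α
  lin-supported {suc n} s fzero    e≗0 =
    ≈-trans (∙-congˡ (lin-zero (s ∘ fsuc) λ t → e≗0 (fsuc t) λ ())) (identityʳ _)
  lin-supported {suc n} s (fsuc α) e≗0 = ≈-trans
    (∙-cong (reflexive (cong (_·ℤ s fzero) (e≗0 fzero λ ())))
            (lin-supported (s ∘ fsuc) α λ t t≢α → e≗0 (fsuc t) (t≢α ∘ fsuc-injective)))
    (identityˡ _)

  -∙-cross : ∀ x y z w → x - y ≈ z - w → x ∙ w ≈ z ∙ y
  -∙-cross x y z w x-y≈z-w = begin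
    x ∙ w                 ≈⟨ identityʳ _ ⟨
    (x ∙ w) ∙ ε           ≈⟨ ∙-congˡ (inverseˡ y) ⟨
    (x ∙ w) ∙ (y ⁻¹ ∙ y)  ≈⟨ interchange _ _ _ _ ⟩
    (x - y) ∙ (w ∙ y)     ≈⟨ ∙-cong x-y≈z-w (comm w y) ⟩
    (z - w) ∙ (y ∙ w)     ≈⟨ interchange _ _ _ _ ⟩
    (z ∙ y) ∙ (w ⁻¹ ∙ w)  ≈⟨ ∙-congˡ (inverseˡ w) ⟩
    (z ∙ y) ∙ ε           ≈⟨ identityʳ _ ⟩
    z ∙ y                 ∎

-- Coefficients of the extended sequence

InM₀ : ℕ → ℤ → Set
InM₀ m z = InM m z ⊎ z ≡ 0ℤ

InM₀? : ∀ m z → Dec (InM₀ m z)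
InM₀? m z =
  ((ℤ.- ℤ.+ m ℤ.+ ℤ.1ℤ ℤ.≤? z) ×-dec (z ℤ.≤? ℤ.+ m) ×-dec ¬? (z ℤ.≟ 0ℤ)) ⊎-dec (z ℤ.≟ 0ℤ)

+∈M₀ : ∀ {m d} → d ≤ m → InM₀ m (ℤ.+ d)
+∈M₀ {d = zero}            z≤n = inj₂ refl
+∈M₀ {suc zero}    {suc d} d≤m = inj₁ (+≤+ z≤n , +≤+ d≤m , λ ())
+∈M₀ {suc (suc m)} {suc d} d≤m = inj₁ (-≤+ , +≤+ d≤m , λ ())

-∈M₀ : ∀ {m d} → d < m → InM₀ m (ℤ.- ℤ.+ d)
-∈M₀ {d = zero}  _               = inj₂ refl
-∈M₀ {d = suc d} (s≤s (s≤s d≤m)) = inj₁ (-≤- d≤m , -≤+ , λ ())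

⊖∈M₀ : ∀ {m a b} → a ≤ m → b < m → InM₀ m (a ⊖ b)
⊖∈M₀ {a = a} {b} a≤m b<m with ≤-total b a
... | inj₁ b≤a = subst (InM₀ _) (sym (ℤ.⊖-≥ b≤a)) (+∈M₀ (≤-trans (m∸n≤m a b) a≤m))
... | inj₂ a≤b = subst (InM₀ _) (sym (ℤ.⊖-≤ a≤b)) (-∈M₀ (≤-<-trans (m∸n≤m b a) b<m))

suc-toℕ< : ∀ {m} (k : Fin (m ∸ 1)) → suc (toℕ k) < m
suc-toℕ< {suc m} k = s≤s (toℕ<n k)

Admissible : ∀ {n} → ℕ → (Fin n → ℤ) → Set
Admissible m e = (∀ t → InM₀ m (e t)) × 1 ≤ wt e × wt e ≤ 2

module _ {n m : ℕ} where

  coef : J n m → ℤ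
  coef (pos _ k) = ℤ.+ suc (toℕ k)
  coef (neg _ k) = -[1+ toℕ k ]
  coef inf       = 0ℤ

  _≟ʳ_ : (r r′ : Maybe (Fin n)) → Dec (r ≡ r′)
  _≟ʳ_ = ≡-dec _≟ᶠ_

  single : J n m → Fin n → ℤ
  single j t = if does (residue j ≟ʳ just t) then coef j else 0ℤ

  pair : J n m → J n m → Fin n → ℤ
  pair a b t = single a t ℤ.+ single b t

  single-at : ∀ j {t} → residue j ≡ just t → single j t ≡ coef j
  single-at j {t} rⱼ rewrite dec-true (residue j ≟ʳ just t) rⱼ = refl

  single-off : ∀ j {t} → residue j ≢ just t → single j t ≡ 0ℤ
  single-off j {t} rⱼ≢ rewrite dec-false (residue j ≟ʳ just t) rⱼ≢ = refl

  single-supported : ∀ j {α} → residue j ≡ just α → ∀ t → t ≢ α → single j t ≡ 0ℤ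
  single-supported j rⱼ t t≢α = single-off j λ rⱼ′ → t≢α (just-injective (trans (sym rⱼ′) rⱼ))

  coef∈M₀ : ∀ j → InM₀ m (coef j)
  coef∈M₀ (pos _ k) = +∈M₀ (toℕ<n k)
  coef∈M₀ (neg _ k) = -∈M₀ (suc-toℕ< k)
  coef∈M₀ inf       = inj₂ refl

  coef≢0 : ∀ j {t} → residue j ≡ just t → coef j ≢ 0ℤ
  coef≢0 (pos _ _) _ ()
  coef≢0 (neg _ _) _ ()

  ≡ₙ∧coef⇒≡ : ∀ {a b : J n m} → a ≡ₙ b → coef a ≡ coef b → a ≡ b
  ≡ₙ∧coef⇒≡ {pos α k} {pos .α k′} refl e =
    cong (pos α) (toℕ-injective (suc-injective (ℤ.+-injective e)))
  ≡ₙ∧coef⇒≡ {neg α k} {neg .α k′} refl e = cong (neg α) (toℕ-injective (ℤ.-[1+-injective e))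
  ≡ₙ∧coef⇒≡ {pos α k} {neg .α k′} refl ()
  ≡ₙ∧coef⇒≡ {neg α k} {pos .α k′} refl ()
  ≡ₙ∧coef⇒≡ {inf}     {inf}       refl _ = refl

  residue-view : ∀ (j : J n m) → (∃ λ t → residue j ≡ just t) ⊎ j ≡ inf
  residue-view (pos α _) = inj₁ (α , refl)
  residue-view (neg α _) = inj₁ (α , refl)
  residue-view inf       = inj₂ refl

  single∈M₀ : ∀ j t → InM₀ m (single j t)
  single∈M₀ j t with does (residue j ≟ʳ just t)
  ... | true  = coef∈M₀ j
  ... | false = inj₂ refl

  wt-single≤1 : ∀ j → wt (single j) ≤ 1
  wt-single≤1 j with residue-view j
  ... | inj₁ (α , rⱼ) = wt-supported (single j) α (single-supported j rⱼ)
  ... | inj₂ refl     = subst (_≤ 1) (sym (wt-zero (single inf) λ _ → refl)) z≤n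

  pair-comm : ∀ a b t → pair a b t ≡ pair b a t
  pair-comm a b t = ℤ.+-comm (single a t) (single b t)

  pair-at : ∀ {a b t} → ¬ a ≡ₙ b → residue a ≡ just t → pair a b t ≡ coef a
  pair-at {a} {b} a≢b rₐ = trans
    (cong₂ ℤ._+_ (single-at a rₐ) (single-off b λ r_b → a≢b (trans rₐ (sym r_b))))
    (ℤ.+-identityʳ (coef a))

  pair-atʳ : ∀ {a b t} → ¬ a ≡ₙ b → residue b ≡ just t → pair a b t ≡ coef b
  pair-atʳ {a} {b} {t} a≢b r_b = trans (pair-comm a b t) (pair-at (a≢b ∘ sym) r_b)

  pair-support : ∀ a b {t} → pair a b t ≢ 0ℤ → residue a ≡ just t ⊎ residue b ≡ just t
  pair-support a b {t} p≢0 = go (residue a ≟ʳ just t) (residue b ≟ʳ just t)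
    where
    go : Dec (residue a ≡ just t) → Dec (residue b ≡ just t) →
         residue a ≡ just t ⊎ residue b ≡ just t
    go (yes rₐ) _         = inj₁ rₐ
    go (no _)   (yes r_b) = inj₂ r_b
    go (no rₐ≢) (no r_b≢) =
      contradiction (cong₂ ℤ._+_ (single-off a rₐ≢) (single-off b r_b≢)) p≢0

  pair-nonzero : ∀ {a b} → ¬ a ≡ₙ b → ∃ λ t → pair a b t ≢ 0ℤ
  pair-nonzero {a} {b} a≢b with residue-view a | residue-view b
  ... | inj₁ (t , rₐ) | _              = t , coef≢0 a rₐ ∘ trans (sym (pair-at a≢b rₐ))
  ... | inj₂ _        | inj₁ (t , r_b) = t , coef≢0 b r_b ∘ trans (sym (pair-atʳ a≢b r_b))
  ... | inj₂ refl     | inj₂ refl      = contradiction refl a≢b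

  pair∈M₀ : ∀ {a b} → ¬ a ≡ₙ b → ∀ t → InM₀ m (pair a b t)
  pair∈M₀ {a} {b} a≢b t = go (residue a ≟ʳ just t)
    where
    go : Dec (residue a ≡ just t) → InM₀ m (pair a b t)
    go (yes rₐ) = subst (InM₀ m) (sym (pair-at a≢b rₐ)) (coef∈M₀ a)
    go (no rₐ≢) = subst (InM₀ m)
      (sym (trans (cong (ℤ._+ single b t) (single-off a rₐ≢)) (ℤ.+-identityˡ _))) (single∈M₀ b t)

  wt-pair≤2 : ∀ a b → wt (pair a b) ≤ 2
  wt-pair≤2 a b = ≤-trans (wt-+ (single a) (single b)) (+-mono-≤ (wt-single≤1 a) (wt-single≤1 b))

  pair-admissible : ∀ {a b} → ¬ a ≡ₙ b → Admissible m (pair a b)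
  pair-admissible {a} {b} a≢b =
    let t , pₜ≢0 = pair-nonzero a≢b in pair∈M₀ a≢b , wt-pos (pair a b) t pₜ≢0 , wt-pair≤2 a b

  ≗pair⇒residue : ∀ {a b a′ b′ t} → ¬ a ≡ₙ b → (∀ t → pair a b t ≡ pair a′ b′ t) →
                  residue a ≡ just t → residue a′ ≡ just t ⊎ residue b′ ≡ just t
  ≗pair⇒residue {a} {b} {a′} {b′} {t} a≢b p≗p′ rₐ =
    pair-support a′ b′ λ p′≡0 → coef≢0 a rₐ (trans (sym (pair-at a≢b rₐ)) (trans (p≗p′ t) p′≡0))

  ≗pair⇒member : ∀ {a b a′ b′} → ¬ a ≡ₙ b → ¬ a′ ≡ₙ b′ → (∀ t → pair a b t ≡ pair a′ b′ t) →
                 a′ ≡ a ⊎ a′ ≡ b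
  ≗pair⇒member {a} {b} {a′} {b′} a≢b a′≢b′ p≗p′ with residue-view a′
  ... | inj₁ (t , rₐ′) with ≗pair⇒residue {a′ = a} {b} a′≢b′ (sym ∘ p≗p′) rₐ′
  ...   | inj₁ rₐ  = inj₁ (≡ₙ∧coef⇒≡ (trans rₐ′ (sym rₐ))
                       (trans (sym (pair-at a′≢b′ rₐ′)) (trans (sym (p≗p′ t)) (pair-at a≢b rₐ))))
  ...   | inj₂ r_b = inj₂ (≡ₙ∧coef⇒≡ (trans rₐ′ (sym r_b))
                       (trans (sym (pair-at a′≢b′ rₐ′)) (trans (sym (p≗p′ t)) (pair-atʳ a≢b r_b))))
  ≗pair⇒member {a} {b} {a′} {b′} a≢b a′≢b′ p≗p′ | inj₂ refl with residue-view a | residue-view b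
  ... | inj₂ refl      | _                = inj₁ refl
  ... | inj₁ _         | inj₂ refl        = inj₂ refl
  ... | inj₁ (tₐ , rₐ) | inj₁ (t_b , r_b) =
    contradiction (trans rₐ (trans (sym (at-b′ a≢b p≗p′ rₐ)) (trans (at-b′ b≢a p≗p′ᵀ r_b) (sym r_b))))
                  a≢b
    where
    -- a′ = ∞, so every residue carried by the left-hand pair is that of b′
    at-b′ : ∀ {x y t} → ¬ x ≡ₙ y → (∀ t → pair x y t ≡ pair inf b′ t) → residue x ≡ just t →
            residue b′ ≡ just t
    at-b′ x≢y q≗q′ rₓ with ≗pair⇒residue {a′ = inf} x≢y q≗q′ rₓ
    ... | inj₂ r_b′ = r_b′
    b≢a : ¬ b ≡ₙ a
    b≢a = a≢b ∘ sym
    p≗p′ᵀ : ∀ t → pair b a t ≡ pair inf b′ t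
    p≗p′ᵀ t = trans (pair-comm b a t) (p≗p′ t)

  pair-injective : ∀ {a b a′ b′} → ¬ a ≡ₙ b → ¬ a′ ≡ₙ b′ → (∀ t → pair a b t ≡ pair a′ b′ t) →
                   (a′ ≡ a × b′ ≡ b) ⊎ (a′ ≡ b × b′ ≡ a)
  pair-injective {a′ = a′} {b′} a≢b a′≢b′ p≗p′
    with ≗pair⇒member a≢b a′≢b′ p≗p′
       | ≗pair⇒member a≢b (a′≢b′ ∘ sym) (λ t → trans (p≗p′ t) (pair-comm a′ b′ t))
  ... | inj₁ refl | inj₁ refl = contradiction refl a′≢b′
  ... | inj₁ refl | inj₂ refl = inj₁ (refl , refl)
  ... | inj₂ refl | inj₁ refl = inj₂ (refl , refl)
  ... | inj₂ refl | inj₂ refl = contradiction refl a′≢b′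

  Overflow : J n m → J n m → Set
  Overflow i l = i ≡ₙ l × ¬ InM₀ m (coef i ℤ.+ coef l)

  Overflow? : ∀ i l → Dec (Overflow i l)
  Overflow? i l = (i ≡ₙ? l) ×-dec ¬? (InM₀? m (coef i ℤ.+ coef l))

  pair∈M₀-≡ₙ : ∀ {i l} → i ≡ₙ l → ¬ Overflow i l → ∀ t → InM₀ m (pair i l t)
  pair∈M₀-≡ₙ {i} {l} i≡l ¬ov t = go (residue i ≟ʳ just t)
    where
    go : Dec (residue i ≡ just t) → InM₀ m (pair i l t)
    go (yes rᵢ) = subst (InM₀ m)
      (sym (cong₂ ℤ._+_ (single-at i rᵢ) (single-at l (trans (sym i≡l) rᵢ))))
      (decidable-stable (InM₀? m _) λ ¬∈ → ¬ov (i≡l , ¬∈))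
    go (no rᵢ≢) = inj₂ (cong₂ ℤ._+_ (single-off i rᵢ≢) (single-off l (rᵢ≢ ∘ trans i≡l)))

  pair-admissible-≡ₙ : ∀ {i l t} → i ≡ₙ l → ¬ Overflow i l → pair i l t ≢ 0ℤ →
                       Admissible m (pair i l)
  pair-admissible-≡ₙ {i} {l} {t} i≡l ¬ov pₜ≢0 =
    pair∈M₀-≡ₙ i≡l ¬ov , wt-pos (pair i l) t pₜ≢0 , wt-pair≤2 i l

  overflowPartners : J n m → List (J n m)
  overflowPartners (pos α k) = map (pos α) (topFins m (suc (toℕ k)))
  overflowPartners (neg α k) = map (neg α) (topFins (m ∸ 1) (suc (toℕ k)))
  overflowPartners inf       = []

  overflow⇒∈partners : ∀ {i l} → Overflow i l → l ∈ overflowPartners i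
  overflow⇒∈partners {pos α k} {pos .α k′} (refl , ¬∈) =
    ∈-map⁺ (pos α) (∈-filter⁺ _ (∈-allFin k′) (≰⇒> (¬∈ ∘ +∈M₀)))
  overflow⇒∈partners {neg α k} {neg .α k′} (refl , ¬∈) =
    ∈-map⁺ (neg α) (∈-filter⁺ _ (∈-allFin k′)
      (subst (m ∸ 1 <_) (cong suc (sym (+-suc (toℕ k) (toℕ k′))))
        (s≤s (∸-monoˡ-≤ 1 (≮⇒≥ (¬∈ ∘ -∈M₀))))))
  overflow⇒∈partners {pos α k} {neg .α k′} (refl , ¬∈) =
    contradiction (⊖∈M₀ (toℕ<n k) (suc-toℕ< k′)) ¬∈
  overflow⇒∈partners {neg α k} {pos .α k′} (refl , ¬∈) =
    contradiction (⊖∈M₀ (toℕ<n k′) (suc-toℕ< k)) ¬∈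
  overflow⇒∈partners {inf}     {inf}       (refl , ¬∈) = contradiction (inj₂ refl) ¬∈

  length-overflowPartners : ∀ i → length (overflowPartners i) ≤ ℤ.∣ coef i ∣
  length-overflowPartners (pos α k) = ≤-trans
    (≤-reflexive (length-map (pos α) (topFins m (suc (toℕ k)))))
    (length-topFins m (suc (toℕ k)))
  length-overflowPartners (neg α k) = ≤-trans
    (≤-reflexive (length-map (neg {m = m} α) (topFins (m ∸ 1) (suc (toℕ k)))))
    (length-topFins (m ∸ 1) (suc (toℕ k)))
  length-overflowPartners inf       = z≤n

module _ {n m : ℕ} where

  allJ≡ : allJ n m ≡ inf ∷ cartesianProductWith pos (allFin n) (allFin m)
                         ++ cartesianProductWith neg (allFin n) (allFin (m ∸ 1))
  allJ≡ = cong₂ (λ ps qs → inf ∷ ps ++ qs)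
    (concatMap-map≡cartesianProductWith pos (allFin n) (allFin m))
    (concatMap-map≡cartesianProductWith neg (allFin n) (allFin (m ∸ 1)))

  allJ-unique : Unique (allJ n m)
  allJ-unique rewrite allJ≡ = All.tabulate inf∉ ∷ ++⁺
    (cartesianProductWith⁺ pos (λ { refl → refl , refl }) (allFin⁺ n) (allFin⁺ m))
    (cartesianProductWith⁺ neg (λ { refl → refl , refl }) (allFin⁺ n) (allFin⁺ (m ∸ 1)))
    pos∉neg
    where
    ps qs : List (J n m)
    ps = cartesianProductWith pos (allFin n) (allFin m)
    qs = cartesianProductWith neg (allFin n) (allFin (m ∸ 1))
    pos∉neg : ∀ {j} → j ∈ ps × j ∈ qs → ⊥
    pos∉neg (j∈ps , j∈qs) with ∈-cartesianProductWith⁻ pos (allFin n) (allFin m) j∈ps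
                             | ∈-cartesianProductWith⁻ neg (allFin n) (allFin (m ∸ 1)) j∈qs
    ... | _ , _ , _ , _ , refl | _ , _ , _ , _ , ()
    inf∉ : ∀ {j} → j ∈ ps ++ qs → inf ≢ j
    inf∉ j∈ with ∈-++⁻ ps j∈
    ... | inj₁ j∈ps with ∈-cartesianProductWith⁻ pos (allFin n) (allFin m) j∈ps
    ...   | _ , _ , _ , _ , refl = λ ()
    inf∉ j∈ | inj₂ j∈qs with ∈-cartesianProductWith⁻ neg (allFin n) (allFin (m ∸ 1)) j∈qs
    ...   | _ , _ , _ , _ , refl = λ ()

  ∑-allJ : ∀ (f : J n m → ℕ) → ∑[ j ∈ allJ n m ] f j
         ≡ f inf + (∑[ α ∈ allFin n ] ∑[ k ∈ allFin m ] f (pos α k)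
                    + ∑[ α ∈ allFin n ] ∑[ k ∈ allFin (m ∸ 1) ] f (neg α k))
  ∑-allJ f = begin
    ∑[ j ∈ allJ n m ] f j
      ≡⟨ cong (λ js → ∑[ j ∈ js ] f j) allJ≡ ⟩
    f inf + ∑[ j ∈ ps ++ qs ] f j
      ≡⟨ cong (f inf +_) (trans (∑-++ f ps qs) (cong₂ _+_
           (∑-cartesianProductWith f pos (allFin n) (allFin m))
           (∑-cartesianProductWith f neg (allFin n) (allFin (m ∸ 1))))) ⟩
    f inf + (∑[ α ∈ allFin n ] ∑[ k ∈ allFin m ] f (pos α k)
             + ∑[ α ∈ allFin n ] ∑[ k ∈ allFin (m ∸ 1) ] f (neg α k)) ∎
    where
    open ≡-Reasoning
    ps qs : List (J n m)
    ps = cartesianProductWith pos (allFin n) (allFin m)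
    qs = cartesianProductWith neg (allFin n) (allFin (m ∸ 1))

  ∑-∣coef∣ : ∑[ j ∈ allJ n m ] ℤ.∣ coef j ∣ ≡ n * (m * m)
  ∑-∣coef∣ = begin
    ∑[ j ∈ allJ n m ] ℤ.∣ coef j ∣
      ≡⟨ ∑-allJ (λ j → ℤ.∣ coef j ∣) ⟩
    ∑[ α ∈ allFin n ] ∑[ k ∈ allFin m ] suc (toℕ k)
      + ∑[ α ∈ allFin n ] ∑[ k ∈ allFin (m ∸ 1) ] suc (toℕ k)
      ≡⟨ cong₂ _+_ (∑-allFin-const (∑-allFin m suc)) (∑-allFin-const (∑-allFin (m ∸ 1) suc)) ⟩
    n * triangle m + n * triangle (m ∸ 1)
      ≡⟨ *-distribˡ-+ n (triangle m) (triangle (m ∸ 1)) ⟨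
    n * (triangle m + triangle (m ∸ 1))
      ≡⟨ cong (n *_) (triangle+triangle-pred m) ⟩
    n * (m * m) ∎
    where
    open ≡-Reasoning
    ∑-allFin-const : ∀ {c d} → c ≡ d → ∑[ α ∈ allFin n ] c ≡ n * d
    ∑-allFin-const {c} refl =
      trans (∑-const c (allFin n)) (cong (_* c) (length-tabulate {n = n} (λ α → α)))

  #overflow≤∣coef∣ : ∀ i → length (filter (Overflow? i) (allJ n m)) ≤ ℤ.∣ coef i ∣
  #overflow≤∣coef∣ i = ≤-trans
    (length-≤-⊆ (filter⁺ (Overflow? i) allJ-unique)
                (overflow⇒∈partners ∘ proj₂ ∘ ∈-filter⁻ (Overflow? i)))
    (length-overflowPartners i)

module _ {c ℓ : Level} (G : AbelianGroup c ℓ) where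
  open AbelianGroup G renaming (refl to ≈-refl; sym to ≈-sym; trans to ≈-trans)
  open GroupDefs G
  open LinearCombinations G

  sJ≈lin-single : ∀ {n m} (s : Fin n → Carrier) (j : J n m) → sJ s j ≈ lin (single j) s
  sJ≈lin-single s (pos α k) = ≈-sym (≈-trans
    (lin-supported s α (single-supported (pos α k) refl))
    (reflexive (cong (_·ℤ s α) (single-at (pos α k) refl))))
  sJ≈lin-single {m = m} s (neg α k) = ≈-sym (≈-trans
    (lin-supported s α (single-supported (neg {m = m} α k) refl))
    (reflexive (cong (_·ℤ s α) (single-at (neg {m = m} α k) refl))))
  sJ≈lin-single s inf = ≈-sym (lin-zero s λ _ → refl)

  sJ-∙≈lin-pair : ∀ {n m} (s : Fin n → Carrier) (a b : J n m) →
                  sJ s a ∙ sJ s b ≈ lin (pair a b) s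
  sJ-∙≈lin-pair s a b = ≈-trans (∙-cong (sJ≈lin-single s a) (sJ≈lin-single s b))
                                (≈-sym (lin-homo-+ (single a) (single b) s))

module Bound {c ℓ : Level} (G : AbelianGroup c ℓ) (_≟_ : Decidable (AbelianGroup._≈_ G))
             {n m : ℕ} (s : Fin n → AbelianGroup.Carrier G) (D : GroupDefs.Diamond G (InM m) 2 s)
             where
  open AbelianGroup G renaming (refl to ≈-refl; sym to ≈-sym; trans to ≈-trans)
  open GroupDefs G
  open Count _≟_
  open LinearCombinations G

  lin≉ε : ∀ {e} → Admissible m e → ¬ lin e s ≈ ε
  lin≉ε (e∈M₀ , 1≤wt , wt≤2) = proj₁ (D _ _ e∈M₀ 1≤wt wt≤2 e∈M₀ 1≤wt wt≤2)

  lin-injective : ∀ {e e′} → Admissible m e → Admissible m e′ →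
                  lin e s ≈ lin e′ s → ∀ t → e t ≡ e′ t
  lin-injective (e∈M₀ , 1≤wt , wt≤2) (e′∈M₀ , 1≤wt′ , wt′≤2) =
    proj₂ (D _ _ e∈M₀ 1≤wt wt≤2 e′∈M₀ 1≤wt′ wt′≤2)

  Good : J n m → J n m → J n m → J n m → Set ℓ
  Good i j k l = ¬ i ≡ₙ j × ¬ k ≡ₙ l × i ≡ₙ l × ¬ k ≡ₙ j × sJ s i - sJ s j ≈ sJ s k - sJ s l

  good⇒lin-pair≈ : ∀ {i j k l} → Good i j k l → lin (pair i l) s ≈ lin (pair k j) s
  good⇒lin-pair≈ {i} {j} {k} {l} (_ , _ , _ , _ , si-sj≈sk-sl) = ≈-trans
    (≈-sym (sJ-∙≈lin-pair G s i l)) (≈-trans (-∙-cross _ _ _ _ si-sj≈sk-sl) (sJ-∙≈lin-pair G s k j))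

  -- E = pair i l is nonzero (else s_k + s_j = 0) and admissible, so ◇₂ gives E = pair k j;
  -- but E lives on the residue of i ≡ l, which is that of neither k nor j.
  ¬overflow⇒¬good : ∀ {i j k l} → ¬ Overflow i l → ¬ Good i j k l
  ¬overflow⇒¬good {i} {j} {k} {l} ¬ov g@(i≢j , k≢l , i≡l , k≢j , _) =
    [ (λ r_k → k≢l (trans r_k (sym rₗ))) , (λ r_j → i≢j (trans (trans i≡l rₗ) (sym r_j))) ]′
      (pair-support k j Fₜ≢0)
    where
    E≢0 : ¬ (∀ t → pair i l t ≡ 0ℤ)
    E≢0 E≡0 = lin≉ε (pair-admissible k≢j) (≈-trans (≈-sym (good⇒lin-pair≈ g)) (lin-zero s E≡0))
    t : Fin n
    t = proj₁ (¬∀⟶∃¬ n _ (λ t → pair i l t ℤ.≟ 0ℤ) E≢0)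
    Eₜ≢0 : pair i l t ≢ 0ℤ
    Eₜ≢0 = proj₂ (¬∀⟶∃¬ n _ (λ t → pair i l t ℤ.≟ 0ℤ) E≢0)
    rₗ : residue l ≡ just t
    rₗ = [ trans (sym i≡l) , (λ r → r) ]′ (pair-support i l Eₜ≢0)
    Fₜ≢0 : pair k j t ≢ 0ℤ
    Fₜ≢0 Fₜ≡0 = Eₜ≢0 (trans (lin-injective (pair-admissible-≡ₙ i≡l ¬ov Eₜ≢0) (pair-admissible k≢j)
                                           (good⇒lin-pair≈ g) t) Fₜ≡0)

  good-unique : ∀ {i j k l j′ k′} → Good i j k l → Good i j′ k′ l →
                (j′ , k′) ≡ (j , k) ⊎ (j′ , k′) ≡ (k , j)
  good-unique g@(_ , _ , _ , k≢j , _) g′@(_ , _ , _ , k′≢j′ , _)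
    with pair-injective k≢j k′≢j′
           (lin-injective (pair-admissible k≢j) (pair-admissible k′≢j′)
                          (≈-trans (≈-sym (good⇒lin-pair≈ g)) (good⇒lin-pair≈ g′)))
  ... | inj₁ (refl , refl) = inj₁ refl
  ... | inj₂ (refl , refl) = inj₂ refl

  pairs : List (J n m × J n m)
  pairs = cartesianProduct (allJ n m) (allJ n m)

  goodPair? : ∀ i l (p : J n m × J n m) → Dec (Good i (proj₁ p) (proj₂ p) l)
  goodPair? i l (j , k) = good? s (i , j , k , l)

  #goodPairs≤2 : ∀ i l → length (filter (goodPair? i l) pairs) ≤ 2
  #goodPairs≤2 i l with any? (goodPair? i l) pairs
  ... | no none =
    subst (_≤ 2) (sym (cong length (filter-none (goodPair? i l) (¬Any⇒All¬ pairs none)))) z≤n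
  ... | yes some with satisfied some
  ...   | (j₀ , k₀) , g₀ = length-≤-⊆ {ys = (j₀ , k₀) ∷ (k₀ , j₀) ∷ []}
    (filter⁺ (goodPair? i l) (cartesianProduct⁺ allJ-unique allJ-unique))
    λ p∈ → [ here , there ∘ here ]′ (good-unique g₀ (proj₂ (∈-filter⁻ (goodPair? i l) p∈)))

  #goodPairs≤ : ∀ i l → length (filter (goodPair? i l) pairs) ≤ 2 * 𝟙 (Overflow? i l)
  #goodPairs≤ i l = bound (Overflow? i l)
    where
    bound : (ov? : Dec (Overflow i l)) → length (filter (goodPair? i l) pairs) ≤ 2 * 𝟙 ov?
    bound (yes _)  = #goodPairs≤2 i l
    bound (no ¬ov) = ≤-reflexive (cong length
      (filter-none (goodPair? i l) (All.universal (λ _ → ¬overflow⇒¬good ¬ov) pairs)))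

  M₁≤ : M₁ n m s ≤ 2 * (n * (m * m))
  M₁≤ = begin
    M₁ n m s
      ≡⟨ length-filter≡∑𝟙 (good? s) (allQuads n m) ⟩
    ∑[ q ∈ allQuads n m ] 𝟙 (good? s q)
      ≡⟨ ∑-quadruples js (𝟙 ∘ good? s) ⟩
    ∑[ i ∈ js ] ∑[ l ∈ js ] ∑[ p ∈ pairs ] 𝟙 (goodPair? i l p)
      ≡⟨ ∑-cong js (λ i → ∑-cong js λ l → length-filter≡∑𝟙 (goodPair? i l) pairs) ⟨
    ∑[ i ∈ js ] ∑[ l ∈ js ] length (filter (goodPair? i l) pairs)
      ≤⟨ ∑-mono-≤ js (λ i → ∑-mono-≤ js (#goodPairs≤ i)) ⟩
    ∑[ i ∈ js ] ∑[ l ∈ js ] (2 * 𝟙 (Overflow? i l))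
      ≡⟨ ∑-cong js (λ i → trans (∑-*-distribˡ 2 (𝟙 ∘ Overflow? i) js)
                                (cong (2 *_) (sym (length-filter≡∑𝟙 (Overflow? i) js)))) ⟩
    ∑[ i ∈ js ] (2 * length (filter (Overflow? i) js))
      ≤⟨ ∑-mono-≤ js (λ i → *-monoʳ-≤ 2 (#overflow≤∣coef∣ i)) ⟩
    ∑[ i ∈ js ] (2 * ℤ.∣ coef i ∣)
      ≡⟨ ∑-*-distribˡ 2 (λ i → ℤ.∣ coef i ∣) js ⟩
    2 * ∑[ i ∈ js ] ℤ.∣ coef i ∣
      ≡⟨ cong (2 *_) (∑-∣coef∣ {n} {m}) ⟩
    2 * (n * (m * m)) ∎
    where
    open ≤-Reasoning
    js : List (J n m)
    js = allJ n m

lemma5 : ∀ {c ℓ : Level} (G : AbelianGroup c ℓ)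
           (_≟_ : Decidable (AbelianGroup._≈_ G))
           (N : ℕ) (enum : Fin N → AbelianGroup.Carrier G)
           (surj : ∀ x → ∃ λ a → AbelianGroup._≈_ G (enum a) x)
           (m n : ℕ) → 2 ≤ m → 1 ≤ n →
           (s : Fin n → AbelianGroup.Carrier G) →
           GroupDefs.Diamond G (InM m) 2 s →
           GroupDefs.Count.M₁ G _≟_ n m s ≤ 2 * m * m * n
lemma5 G _≟_ _ _ _ m n _ _ s D = ≤-trans (Bound.M₁≤ G _≟_ s D) (≤-reflexive (reorder m n))
  where
  reorder : ∀ m n → 2 * (n * (m * m)) ≡ 2 * m * m * n
  reorder = solve-∀
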